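{- Let $G$ be a finite connected distance-regular graph with diameter $d$, and let $\lambda_0=\kappa,\lambda_1,\dots,\lambda_d$, $p_m$, $q_m$ and $\phi_i(z;G)$ be as in the context. Then for every $i=1,\dots,d$ (not $i=0$): $$\phi_i(z;G)=(1-z)\sum_{m=0}^{d-1}q_m(\lambda_i)z^m,\qquad p_d(\lambda_i)=-q_{d-1}(\lambda_i),\qquad q_d(\lambda_i)=0.$$
   Context: $G$ is a finite connected graph with diameter $d$; $G_i(x)$ is the set of vertices at distance $i$ from $x$. $G$ is distance-regular if $|G_j(x)\cap G_k(y)|$ depends only on $\mathrm{dist}(x,y)$; denote it $n^i_{jk}$ when $\mathrm{dist}(x,y)=i$. $G$ is then $\kappa$-regular. Intersection numbers: $b_i=n^i_{i+1,1}$ ($0\le i\le d-1$), $c_i=n^i_{i-1,1}$ ($1\le i\le d$), $b_d=c_0=0$, $a_i=\kappa-b_i-c_i$. $Q$ is the $(d+1)\times(d+1)$ tridiagonal matrix indexed by $0,\dots,d$ with $Q_{k,k+1}=b_k$, $Q_{k,k-1}=c_k$, $Q_{k,k}=a_k$; it has $d+1$ distinct real eigenvalues (the distinct adjacency eigenvalues of $G$), labelled $\lambda_0=\kappa,\lambda_1,\dots,\lambda_d$. Polynomials: $p_0(z)=1$, $p_1(z)=z$, $z\,p_m(z)=c_{m+1}p_{m+1}(z)+a_mp_m(z)+b_{m-1}p_{m-1}(z)$ for $1\le m\le d-1$, and $p_d$ is the polynomial obtained from this recurrence with $m=d-1$. Set $q_m(z)=\sum_{l=0}^m p_l(z)$ and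 define the spectral polynomials $\phi_i(z;G)=\sum_{m=0}^d p_m(\lambda_i)z^m$. -}

module Defs where

open import Level using (Level; _⊔_) renaming (suc to lsuc)
open import Data.Nat using (ℕ; zero; suc; _≤_; _<_; _∸_)
open import Data.Nat as ℕ using ()
open import Data.Bool using (Bool; true; false; if_then_else_)
open import Data.Fin using (Fin; toℕ)
open import Data.List using (List; length; filter; allFin)
open import Data.Product using (Σ; _×_; ∃)
open import Relation.Binary.PropositionalEquality using (_≡_)
open import Relation.Nullary using (¬_)
open import Relation.Nullary.Decidable using (_×-dec_)
open import Algebra.Bundles using (CommutativeRing)

record Graph (n : ℕ) : Set where
  field
    adj    : Fin n → Fin n → Bool
    sym    : ∀ x y → adj x y ≡ adj y x
    irrefl : ∀ x → adj x x ≡ false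

module _ {n : ℕ} (G : Graph n) where
  open Graph G

  data Walk : Fin n → Fin n → ℕ → Set where
    here : ∀ x → Walk x x 0
    step : ∀ {x y z k} → adj x y ≡ true → Walk y z k → Walk x z (suc k)

  Connected : Set
  Connected = ∀ x y → ∃ λ k → Walk x y k

  IsDistance : (Fin n → Fin n → ℕ) → Set
  IsDistance δ = ∀ x y → Walk x y (δ x y) × (∀ m → Walk x y m → δ x y ≤ m)

  IsDiameter : (Fin n → Fin n → ℕ) → ℕ → Set
  IsDiameter δ d = (∀ x y → δ x y ≤ d) × Σ (Fin n) λ x → Σ (Fin n) λ y → δ x y ≡ d

count : ∀ {n} → (Fin n → Fin n → ℕ) → ℕ → ℕ → Fin n → Fin n → ℕ
count {n} δ j k x y =
  length (filter (λ z → (δ x z ℕ.≟ j) ×-dec (δ y z ℕ.≟ k)) (allFin n))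

IsDistanceRegular : ∀ {n} → (Fin n → Fin n → ℕ) → Set
IsDistanceRegular {n} δ = ∀ x y x' y' → δ x y ≡ δ x' y' →
  ∀ j k → count δ j k x y ≡ count δ j k x' y'

IsValency : ∀ {n} → (Fin n → Fin n → ℕ) → ℕ → Set
IsValency {n} δ κ = ∀ (x : Fin n) → count δ 1 1 x x ≡ κ

IsBNumbers : ∀ {n} → (Fin n → Fin n → ℕ) → ℕ → (ℕ → ℕ) → Set
IsBNumbers {n} δ d b =
  (∀ i → i < d → ∀ (x y : Fin n) → δ x y ≡ i → b i ≡ count δ (suc i) 1 x y)
  × b d ≡ 0

IsCNumbers : ∀ {n} → (Fin n → Fin n → ℕ) → ℕ → (ℕ → ℕ) → Set
IsCNumbers {n} δ d c =
  (∀ i → 1 ≤ i → i ≤ d → ∀ (x y : Fin n) → δ x y ≡ i → c i ≡ count δ (i ∸ 1) 1 x y)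
  × c 0 ≡ 0

-- Fields of characteristic zero (stand-in for ℝ; agda-stdlib has no reals
-- and no Field bundle).  _⁻¹ is total; its value at 0 is unconstrained.

module _ {c ℓ : Level} (R : CommutativeRing c ℓ) where
  open CommutativeRing R

  ι : ℕ → Carrier
  ι zero    = 0#
  ι (suc m) = 1# + ι m

record CharZeroField (c ℓ : Level) : Set (lsuc (c ⊔ ℓ)) where
  field
    commRing : CommutativeRing c ℓ
  open CommutativeRing commRing hiding (ring)
  field
    _⁻¹      : Carrier → Carrier
    ⁻¹-cong  : ∀ {x y} → x ≈ y → x ⁻¹ ≈ y ⁻¹
    inverseʳ : ∀ x → x ≉ 0# → x * (x ⁻¹) ≈ 1#
    charZero : ∀ m → ι commRing (suc m) ≉ 0#
  open CommutativeRing commRing public hiding (ring)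

module FieldDefs {o ℓ : Level} (F : CharZeroField o ℓ) where
  open CharZeroField F

  ιF : ℕ → Carrier
  ιF = ι commRing

  Σ< : ℕ → (ℕ → Carrier) → Carrier
  Σ< zero    f = 0#
  Σ< (suc m) f = Σ< m f + f m

  ΣFin : ∀ {m} → (Fin m → Carrier) → Carrier
  ΣFin {zero}  f = 0#
  ΣFin {suc m} f = f Fin.zero + ΣFin (λ i → f (Fin.suc i))
    where import Data.Fin as Fin

  pow : Carrier → ℕ → Carrier
  pow z zero    = 1#
  pow z (suc m) = z * pow z m

  module Intersection (κ : ℕ) (b c : ℕ → ℕ) where

    a : ℕ → Carrier
    a k = ιF κ - ιF (b k) - ιF (c k)

    Qℕ : ℕ → ℕ → Carrier
    Qℕ k l =
      if l ℕ.≡ᵇ suc k then ιF (b k)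
      else if k ℕ.≡ᵇ suc l then ιF (c k)
      else if k ℕ.≡ᵇ l then a k
      else 0#

    Q : (d : ℕ) → Fin (suc d) → Fin (suc d) → Carrier
    Q d k l = Qℕ (toℕ k) (toℕ l)

    IsEigenvalueQ : (d : ℕ) → Carrier → Set (o ⊔ ℓ)
    IsEigenvalueQ d μ = Σ (Fin (suc d) → Carrier) λ v →
      (Σ (Fin (suc d)) λ k → v k ≉ 0#) ×
      (∀ k → ΣFin (λ l → Q d k l * v l) ≈ μ * v k)

    -- p_0 = 1, p_1 = z,
    -- z p_m = c_{m+1} p_{m+1} + a_m p_m + b_{m-1} p_{m-1}
    p : ℕ → Carrier → Carrier
    p zero                z = 1#
    p (suc zero)          z = z
    p (suc (suc m))       z =
      (z * p (suc m) z - a (suc m) * p (suc m) z - ιF (b m) * p m z)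
        * (ιF (c (suc (suc m))) ⁻¹)

    q : ℕ → Carrier → Carrier
    q m z = Σ< (suc m) (λ l → p l z)

    φ : (d : ℕ) → Carrier → Carrier → Carrier
    φ d μ z = Σ< (suc d) (λ m → p m μ * pow z m)

module Submission where

-- Write P = (p₀(μ), p₁(μ), …).  The three-term recurrence defining the pₖ says that P
-- solves the rows 0..d-1 of Qᵀ P = μ P.  For a tridiagonal matrix T, Green's identity
-- (a discrete Christoffel–Darboux formula) states: if T V = ν V on rows 0..d and
-- Tᵀ P = μ P on rows 0..d-1, then (ν - μ) Σ_{k≤d} Pₖ Vₖ = r · V_d, where r is the
-- residual of row d of Qᵀ P = μ P.  Applied to an eigenvector V of Q for μ (whose
-- component V_d is nonzero, since the subdiagonal entries cₖ are nonzero) it gives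
-- r = 0; applied to the all-ones vector (rows of Q sum to κ) it gives
-- (κ - μ) q_d(μ) = 0, so q_d(μ) = 0 when μ ≠ κ.  The other two claims follow from
-- q_d = q_{d-1} + p_d and Abel summation.

open import Defs
open import Level using (Level)
open import Data.Nat using (ℕ; suc; _∸_)
open import Data.Fin as Fin using (Fin)
open import Data.Product using (_×_)
open import Relation.Binary.PropositionalEquality using (_≡_; _≢_)

open import Algebra.Bundles using (CommutativeRing)
open import Data.Nat using (zero; _≤_; z≤n; s≤s)
import Data.Nat as ℕ
import Data.Nat.Properties as ℕ
open import Data.Integer as ℤ using (ℤ; +_; -[1+_])
import Data.Integer.Properties as ℤ
import Data.Sign as Sign
open import Data.Maybe using (Maybe; just; nothing)
open import Data.Bool using (true; false; if_then_else_)
open import Data.Fin using (toℕ)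
import Data.Fin.Properties as Fin
open import Data.List using (List; []; _∷_; length; filter; allFin)
open import Data.List.Membership.Propositional using (_∈_)
open import Data.List.Membership.Propositional.Properties using (∈-filter⁺; ∈-filter⁻; ∈-allFin)
open import Data.List.Relation.Unary.Any using (here; there)
open import Data.List.Relation.Unary.All using (_∷_)
open import Data.List.Relation.Unary.AllPairs using (_∷_)
open import Data.List.Relation.Unary.Unique.Propositional using (Unique)
import Data.List.Relation.Unary.Unique.Propositional.Properties as Unique
open import Data.Product using (Σ; _,_; proj₁; proj₂)
open import Data.Sum using (inj₁; inj₂)
open import Data.Empty using (⊥-elim)
import Relation.Binary.PropositionalEquality as ≡
open import Relation.Nullary using (yes; no)
open import Relation.Nullary.Decidable using (_×-dec_)
open import Relation.Unary using (Pred; Decidable)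

-- An integer n is interpreted as the n-fold sum
-- of 1#, computed so that 0 and 1 are interpreted as 0# and 1# on the nose; hence
-- the constants 0# and 1# may appear literally in solver goals.
module IntegerCoefficientSolver {c ℓ : Level} (R : CommutativeRing c ℓ) where
  open CommutativeRing R
  open import Algebra.Properties.Ring ring
    using (-0#≈0#; -‿involutive; -‿distribˡ-*; -‿distribʳ-*; -‿+-comm; x≈y⇒x∙y⁻¹≈ε)
  open import Algebra.Properties.Semiring.Mult.TCOptimised semiring
    using (1+×; ×-homo-+; ×1-homo-*) renaming (_×_ to _×′_)
  open import Algebra.Solver.Ring.AlmostCommutativeRing
    using (AlmostCommutativeRing; fromCommutativeRing; _-Raw-AlmostCommutative⟶_)
  open import Relation.Binary.Reasoning.Setoid setoid

  fromℤ : ℤ → Carrier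
  fromℤ (+ n)    = n ×′ 1#
  fromℤ -[1+ n ] = - (suc n ×′ 1#)

  ⊖-homo : ∀ m n → fromℤ (m ℤ.⊖ n) ≈ m ×′ 1# - n ×′ 1#
  ⊖-homo zero    zero    = sym (x≈y⇒x∙y⁻¹≈ε refl)
  ⊖-homo zero    (suc n) = sym (+-identityˡ _)
  ⊖-homo (suc m) zero    = sym (trans (+-congˡ -0#≈0#) (+-identityʳ _))
  ⊖-homo (suc m) (suc n) = begin
    fromℤ (suc m ℤ.⊖ suc n)    ≡⟨ ≡.cong fromℤ (ℤ.[1+m]⊖[1+n]≡m⊖n m n) ⟩
    fromℤ (m ℤ.⊖ n)            ≈⟨ ⊖-homo m n ⟩
    x - y                      ≈⟨ +-congʳ (+-identityˡ x) ⟨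
    (0# + x) - y               ≈⟨ +-congʳ (+-congʳ (-‿inverseˡ 1#)) ⟨
    ((- 1# + 1#) + x) - y      ≈⟨ +-congʳ (+-assoc _ _ _) ⟩
    (- 1# + (1# + x)) - y      ≈⟨ +-congʳ (+-comm _ _) ⟩
    ((1# + x) + - 1#) - y      ≈⟨ +-assoc _ _ _ ⟩
    (1# + x) + (- 1# + - y)    ≈⟨ +-cong (sym (1+× m 1#)) (-‿+-comm 1# y) ⟩
    suc m ×′ 1# - (1# + y)     ≈⟨ +-congˡ (-‿cong (1+× n 1#)) ⟨
    suc m ×′ 1# - suc n ×′ 1#  ∎
    where x = m ×′ 1#; y = n ×′ 1#

  +-homo : ∀ i j → fromℤ (i ℤ.+ j) ≈ fromℤ i + fromℤ j
  +-homo (+ m)    (+ n)    = ×-homo-+ 1# m n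
  +-homo (+ m)    -[1+ n ] = ⊖-homo m (suc n)
  +-homo -[1+ m ] (+ n)    = trans (⊖-homo n (suc m)) (+-comm _ _)
  +-homo -[1+ m ] -[1+ n ] = begin
    - (suc (suc (m ℕ.+ n)) ×′ 1#)      ≡⟨ ≡.cong (λ k → - (suc k ×′ 1#)) (ℕ.+-suc m n) ⟨
    - ((suc m ℕ.+ suc n) ×′ 1#)        ≈⟨ -‿cong (×-homo-+ 1# (suc m) (suc n)) ⟩
    - (suc m ×′ 1# + suc n ×′ 1#)      ≈⟨ -‿+-comm _ _ ⟨
    - (suc m ×′ 1#) + - (suc n ×′ 1#)  ∎

  ◃⁺-homo : ∀ n → fromℤ (Sign.+ ℤ.◃ n) ≈ n ×′ 1#
  ◃⁺-homo zero    = refl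
  ◃⁺-homo (suc n) = refl

  ◃⁻-homo : ∀ n → fromℤ (Sign.- ℤ.◃ n) ≈ - (n ×′ 1#)
  ◃⁻-homo zero    = sym -0#≈0#
  ◃⁻-homo (suc n) = refl

  *-homo : ∀ i j → fromℤ (i ℤ.* j) ≈ fromℤ i * fromℤ j
  *-homo (+ m)    (+ n)    = trans (◃⁺-homo (m ℕ.* n)) (×1-homo-* m n)
  *-homo (+ m)    -[1+ n ] = begin
    fromℤ (Sign.- ℤ.◃ (m ℕ.* suc n))      ≈⟨ ◃⁻-homo (m ℕ.* suc n) ⟩
    - ((m ℕ.* suc n) ×′ 1#)               ≈⟨ -‿cong (×1-homo-* m (suc n)) ⟩
    - (m ×′ 1# * suc n ×′ 1#)             ≈⟨ -‿distribʳ-* _ _ ⟩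
    m ×′ 1# * - (suc n ×′ 1#)             ∎
  *-homo -[1+ m ] (+ n)    = begin
    fromℤ (Sign.- ℤ.◃ (suc m ℕ.* n))      ≈⟨ ◃⁻-homo (suc m ℕ.* n) ⟩
    - ((suc m ℕ.* n) ×′ 1#)               ≈⟨ -‿cong (×1-homo-* (suc m) n) ⟩
    - (suc m ×′ 1# * n ×′ 1#)             ≈⟨ -‿distribˡ-* _ _ ⟩
    - (suc m ×′ 1#) * n ×′ 1#             ∎
  *-homo -[1+ m ] -[1+ n ] = begin
    fromℤ (Sign.+ ℤ.◃ (suc m ℕ.* suc n))  ≈⟨ ◃⁺-homo (suc m ℕ.* suc n) ⟩
    (suc m ℕ.* suc n) ×′ 1#               ≈⟨ ×1-homo-* (suc m) (suc n) ⟩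
    x * y                                 ≈⟨ -‿involutive _ ⟨
    - - (x * y)                           ≈⟨ -‿cong (-‿distribʳ-* x y) ⟩
    - (x * - y)                           ≈⟨ -‿distribˡ-* x (- y) ⟩
    - x * - y                             ∎
    where x = suc m ×′ 1#; y = suc n ×′ 1#

  -‿homo : ∀ i → fromℤ (ℤ.- i) ≈ - fromℤ i
  -‿homo (+ zero)  = sym -0#≈0#
  -‿homo (+ suc n) = refl
  -‿homo -[1+ n ]  = sym (-‿involutive _)

  private
    ring′ : AlmostCommutativeRing c ℓ
    ring′ = fromCommutativeRing R

    morphism : CommutativeRing.rawRing ℤ.+-*-commutativeRing -Raw-AlmostCommutative⟶ ring′
    morphism = record
      { ⟦_⟧ = fromℤ ; +-homo = +-homo ; *-homo = *-homo ; -‿homo = -‿homo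
      ; 0-homo = refl ; 1-homo = refl }

    _≟_ : ∀ i j → Maybe (fromℤ i ≈ fromℤ j)
    i ≟ j with i ℤ.≟ j
    ... | yes i≡j = just (reflexive (≡.cong fromℤ i≡j))
    ... | no  _   = nothing

  open import Algebra.Solver.Ring _ ring′ morphism _≟_ public
    using (solve; _:=_; _:+_; _:*_; _:-_; con)

module Counting {n : ℕ} {p : Level} {P : Pred (Fin n) p} (P? : Decidable P) where
  open ≡ using (refl; sym; trans)

  #P : ℕ
  #P = length (filter P? (allFin n))

  #P-positive : ∀ w → P w → 1 ≤ #P
  #P-positive w pw with filter P? (allFin n) | ∈-filter⁺ P? (∈-allFin w) pw
  ... | _ ∷ _ | _ = s≤s z≤n

  #P-unique : ∀ w → P w → (∀ z → P z → z ≡ w) → #P ≡ 1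
  #P-unique w pw unique = single (Unique.filter⁺ P? {xs = allFin n} (Unique.allFin⁺ n))
    (λ z∈ → unique _ (proj₂ (∈-filter⁻ P? {xs = allFin n} z∈))) (∈-filter⁺ P? (∈-allFin w) pw)
    where
    single : ∀ {ys : List (Fin n)} → Unique ys → (∀ {z} → z ∈ ys → z ≡ w) → w ∈ ys → length ys ≡ 1
    single {_ ∷ []}    _                _     _ = refl
    single {_ ∷ _ ∷ _} ((y≢y′ ∷ _) ∷ _) all≡w _ =
      ⊥-elim (y≢y′ (trans (all≡w (here refl)) (sym (all≡w (there (here refl))))))

module Distance {n : ℕ} (G : Graph n) (δ : Fin n → Fin n → ℕ) (isDist : IsDistance G δ) where
  open ≡ using (refl; sym; trans; subst)
  open Graph G using (adj; irrefl)

  geodesic : ∀ x y → Walk G x y (δ x y)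
  geodesic x y = proj₁ (isDist x y)

  δ-minimal : ∀ {x y} m → Walk G x y m → δ x y ≤ m
  δ-minimal {x} {y} = proj₂ (isDist x y)

  snoc : ∀ {x y z m} → Walk G x y m → adj y z ≡ true → Walk G x z (suc m)
  snoc (here _)   a = step a (here _)
  snoc (step b w) a = step b (snoc w a)

  reverse : ∀ {x y m} → Walk G x y m → Walk G y x m
  reverse (here x)               = here x
  reverse {x} (step {y = y} a w) = snoc (reverse w) (trans (Graph.sym G y x) a)

  δ-sym : ∀ x y → δ x y ≡ δ y x
  δ-sym x y = ℕ.≤-antisym (δ-minimal _ (reverse (geodesic y x))) (δ-minimal _ (reverse (geodesic x y)))

  δ-refl : ∀ x → δ x x ≡ 0
  δ-refl x = ℕ.n≤0⇒n≡0 (δ-minimal 0 (here x))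

  δ≡0⇒≡ : ∀ {x y} → δ x y ≡ 0 → x ≡ y
  δ≡0⇒≡ {x} {y} eq with subst (Walk G x y) eq (geodesic x y)
  ... | here _ = refl

  δ-adjacent : ∀ {x y} → adj x y ≡ true → δ x y ≡ 1
  δ-adjacent {x} {y} a with δ x y in eq | δ-minimal 1 (step a (here y))
  ... | zero        | _      with trans (sym a) (subst (λ z → adj x z ≡ false) (δ≡0⇒≡ eq) (irrefl x))
  ...   | ()
  δ-adjacent a | suc zero    | _      = refl
  δ-adjacent a | suc (suc _) | s≤s ()

  closerNeighbour : ∀ {x y m} → δ x y ≡ suc m → Σ (Fin n) λ x′ → adj x x′ ≡ true × δ x′ y ≡ m
  closerNeighbour {x} {y} {m} eq with subst (Walk G x y) eq (geodesic x y)
  ... | step {y = x′} a w = x′ , a , ℕ.≤-antisym (δ-minimal m w)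
          (ℕ.≤-pred (subst (_≤ suc (δ x′ y)) eq (δ-minimal _ (step a (geodesic x′ y)))))

  vertexAtDistance : ∀ {x y} m → δ x y ≡ m → ∀ {k} → k ≤ m → Σ (Fin n) λ u → δ u y ≡ k
  vertexAtDistance {x} m eq k≤m with ℕ.m≤n⇒m<n∨m≡n k≤m
  ... | inj₂ refl = x , eq
  vertexAtDistance (suc m) eq k≤m | inj₁ (s≤s k≤m′) =
    vertexAtDistance m (proj₂ (proj₂ (closerNeighbour eq))) k≤m′

module IntersectionNumbers {n : ℕ} (G : Graph n) (δ : Fin n → Fin n → ℕ) (d : ℕ)
                           (isDist : IsDistance G δ) (isDiam : IsDiameter G δ d) where
  open ≡ using (sym; trans; subst)
  open Distance G δ isDist
  open Graph G using (adj)

  x₀ y₀ : Fin n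
  x₀ = proj₁ (proj₂ isDiam)
  y₀ = proj₁ (proj₂ (proj₂ isDiam))

  δx₀y₀≡d : δ x₀ y₀ ≡ d
  δx₀y₀≡d = proj₂ (proj₂ (proj₂ isDiam))

  b₀≡κ : ∀ {κ b} → IsValency δ κ → IsBNumbers δ d b → 1 ≤ d → b 0 ≡ κ
  b₀≡κ valency bNum 1≤d = trans (proj₁ bNum 0 1≤d x₀ x₀ (δ-refl x₀)) (valency x₀)

  -- cₖ counts the neighbours of u lying at distance k-1 from y₀, for u at distance k;
  -- the next vertex on a geodesic from u to y₀ is such a neighbour
  c-positive : ∀ {c} → IsCNumbers δ d c → ∀ k → 1 ≤ k → k ≤ d → 1 ≤ c k
  c-positive cNum (suc k) 1≤k k≤d =
    subst (1 ≤_) (sym (proj₁ cNum (suc k) 1≤k k≤d y₀ u (trans (δ-sym y₀ u) δuy₀)))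
      (Counting.#P-positive (λ z → (δ y₀ z ℕ.≟ k) ×-dec (δ u z ℕ.≟ 1)) u′
        (trans (δ-sym y₀ u′) δu′y₀ , δ-adjacent u~u′))
    where
    u : Fin n
    u = proj₁ (vertexAtDistance d δx₀y₀≡d k≤d)
    δuy₀ : δ u y₀ ≡ suc k
    δuy₀ = proj₂ (vertexAtDistance d δx₀y₀≡d k≤d)
    u′ : Fin n
    u′ = proj₁ (closerNeighbour δuy₀)
    u~u′ : adj u u′ ≡ true
    u~u′ = proj₁ (proj₂ (closerNeighbour δuy₀))
    δu′y₀ : δ u′ y₀ ≡ k
    δu′y₀ = proj₂ (proj₂ (closerNeighbour δuy₀))

  -- for u adjacent to y₀, the only vertex at distance 0 from y₀ is y₀ itself
  c₁≡1 : ∀ {c} → IsCNumbers δ d c → 1 ≤ d → c 1 ≡ 1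
  c₁≡1 cNum 1≤d =
    trans (proj₁ cNum 1 ℕ.≤-refl 1≤d y₀ u (trans (δ-sym y₀ u) δuy₀))
      (Counting.#P-unique (λ z → (δ y₀ z ℕ.≟ 0) ×-dec (δ u z ℕ.≟ 1)) y₀
        (δ-refl y₀ , δuy₀) (λ z pz → sym (δ≡0⇒≡ (proj₁ pz))))
    where
    u : Fin n
    u = proj₁ (vertexAtDistance d δx₀y₀≡d 1≤d)
    δuy₀ : δ u y₀ ≡ 1
    δuy₀ = proj₂ (vertexAtDistance d δx₀y₀≡d 1≤d)

module FieldLemmas {o ℓ : Level} (F : CharZeroField o ℓ) where
  open CharZeroField F
  open FieldDefs F
  open import Relation.Binary.Reasoning.Setoid setoid
  open IntegerCoefficientSolver commRing

  cancel : ∀ {x y} → x ≉ 0# → x * y ≈ 0# → y ≈ 0#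
  cancel {x} {y} x≉0 xy≈0 = begin
    y                  ≈⟨ *-identityˡ y ⟨
    1# * y             ≈⟨ *-congʳ (inverseʳ x x≉0) ⟨
    (x * x ⁻¹) * y     ≈⟨ solve 3 (λ x x⁻¹ y → (x :* x⁻¹) :* y := x⁻¹ :* (x :* y)) refl x (x ⁻¹) y ⟩
    x ⁻¹ * (x * y)     ≈⟨ *-congˡ xy≈0 ⟩
    x ⁻¹ * 0#          ≈⟨ zeroʳ _ ⟩
    0#                 ∎

  *-cancel-⁻¹ : ∀ {x} y → x ≉ 0# → x * (y * x ⁻¹) ≈ y
  *-cancel-⁻¹ {x} y x≉0 = begin
    x * (y * x ⁻¹)     ≈⟨ solve 3 (λ x y x⁻¹ → x :* (y :* x⁻¹) := (x :* x⁻¹) :* y) refl x y (x ⁻¹) ⟩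
    (x * x ⁻¹) * y     ≈⟨ *-congʳ (inverseʳ x x≉0) ⟩
    1# * y             ≈⟨ *-identityˡ y ⟩
    y                  ∎

  ιF-nonzero : ∀ {m} → 1 ≤ m → ιF m ≉ 0#
  ιF-nonzero {suc m} _ = charZero m

  Σ<-cong : ∀ m {f g : ℕ → Carrier} → (∀ k → f k ≈ g k) → Σ< m f ≈ Σ< m g
  Σ<-cong zero    f≈g = refl
  Σ<-cong (suc m) f≈g = +-cong (Σ<-cong m f≈g) (f≈g m)

  ΣFin-cong : ∀ {m} {f g : Fin m → Carrier} → (∀ i → f i ≈ g i) → ΣFin f ≈ ΣFin g
  ΣFin-cong {zero}  f≈g = refl
  ΣFin-cong {suc m} f≈g = +-cong (f≈g Fin.zero) (ΣFin-cong (λ i → f≈g (Fin.suc i)))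

  ΣFin-zero : ∀ {m} {f : Fin m → Carrier} → (∀ i → f i ≈ 0#) → ΣFin f ≈ 0#
  ΣFin-zero {zero}  f≈0 = refl
  ΣFin-zero {suc m} f≈0 =
    trans (+-cong (f≈0 Fin.zero) (ΣFin-zero (λ i → f≈0 (Fin.suc i)))) (+-identityˡ 0#)

  -- a vector indexed by Fin m, read as a sequence that vanishes from index m on
  pad : ∀ {m} → (Fin m → Carrier) → ℕ → Carrier
  pad {zero}  v _       = 0#
  pad {suc m} v zero    = v Fin.zero
  pad {suc m} v (suc l) = pad (λ i → v (Fin.suc i)) l

  pad-toℕ : ∀ {m} (v : Fin m → Carrier) i → pad v (toℕ i) ≡ v i
  pad-toℕ v Fin.zero    = ≡.refl
  pad-toℕ v (Fin.suc i) = pad-toℕ (λ j → v (Fin.suc j)) i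

  pad-end : ∀ m (v : Fin m → Carrier) → pad v m ≡ 0#
  pad-end zero    v = ≡.refl
  pad-end (suc m) v = pad-end m (λ i → v (Fin.suc i))

  abel-summation : ∀ (f : ℕ → Carrier) n z →
    Σ< (suc n) (λ m → f m * pow z m)
      ≈ (1# - z) * Σ< n (λ m → Σ< (suc m) f * pow z m) + Σ< (suc n) f * pow z n
  abel-summation f zero z =
    solve 2 (λ f₀ z → con (+ 0) :+ f₀ :* con (+ 1)
                      := (con (+ 1) :- z) :* con (+ 0) :+ (con (+ 0) :+ f₀) :* con (+ 1)) refl (f 0) z
  abel-summation f (suc n) z = begin
    Σ< (suc n) (λ m → f m * pow z m) + f (suc n) * (z * zⁿ)
      ≈⟨ +-congʳ (abel-summation f n z) ⟩
    (1# - z) * S + Qₙ * zⁿ + f (suc n) * (z * zⁿ)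
      ≈⟨ solve 5 (λ S Qₙ zⁿ f z → (con (+ 1) :- z) :* S :+ Qₙ :* zⁿ :+ f :* (z :* zⁿ)
                   := (con (+ 1) :- z) :* (S :+ Qₙ :* zⁿ) :+ (Qₙ :+ f) :* (z :* zⁿ))
               refl S Qₙ zⁿ (f (suc n)) z ⟩
    (1# - z) * (S + Qₙ * zⁿ) + (Qₙ + f (suc n)) * (z * zⁿ) ∎
    where
    S Qₙ zⁿ : Carrier
    S  = Σ< n (λ m → Σ< (suc m) f * pow z m)
    Qₙ = Σ< (suc n) f
    zⁿ = pow z n

module Tridiagonal {o ℓ : Level} (F : CharZeroField o ℓ) where
  open CharZeroField F hiding (zero)
  open FieldDefs F
  open FieldLemmas F
  open import Relation.Binary.Reasoning.Setoid setoid
  open IntegerCoefficientSolver commRing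

  record Tri : Set o where
    field
      sup sub diag : ℕ → Carrier

  open Tri

  entry : Tri → ℕ → ℕ → Carrier
  entry T k l =
    if l ℕ.≡ᵇ suc k then sup T k
    else if k ℕ.≡ᵇ suc l then sub T k
    else if k ℕ.≡ᵇ l then diag T k
    else 0#

  transpose : Tri → Tri
  transpose T = record { sup = λ l → sub T (suc l) ; sub = λ l → sup T (l ∸ 1) ; diag = diag T }

  shift : Tri → Tri
  shift T = record { sup = λ k → sup T (suc k) ; sub = λ k → sub T (suc k) ; diag = λ k → diag T (suc k) }

  row : Tri → (ℕ → Carrier) → ℕ → Carrier
  row T V zero    = diag T 0 * V 0 + sup T 0 * V 1
  row T V (suc k) = sub T (suc k) * V k + diag T (suc k) * V (suc k) + sup T (suc k) * V (suc (suc k))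

  Solves : Tri → Carrier → (ℕ → Carrier) → ℕ → Set ℓ
  Solves T ν V m = ∀ k → k ≤ m → row T V k ≈ ν * V k

  -- Rows of the leading (m+1)×(m+1) block: when sup m = 0 the truncation loses nothing.
  rowSum : ∀ T (V : ℕ → Carrier) m k → k ≤ m → sup T m ≈ 0# →
           ΣFin {suc m} (λ l → entry T k (toℕ l) * V (toℕ l)) ≈ row T V k
  rowSum T V zero zero _ sup≈0 = +-congˡ (sym (trans (*-congʳ sup≈0) (zeroˡ (V 1))))
  rowSum T V (suc m) zero _ _ =
    +-congˡ (trans (+-congˡ (ΣFin-zero {m} (λ i → zeroˡ (V (suc (suc (toℕ i))))))) (+-identityʳ _))
  rowSum T V (suc m) (suc zero) (s≤s k≤m) sup≈0 =
    trans (+-congˡ (rowSum (shift T) (λ l → V (suc l)) m zero k≤m sup≈0)) (sym (+-assoc _ _ _))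
  rowSum T V (suc m) (suc (suc k)) (s≤s k≤m) sup≈0 =
    trans (+-congʳ (zeroˡ (V 0)))
      (trans (+-identityˡ _) (rowSum (shift T) (λ l → V (suc l)) m (suc k) k≤m sup≈0))

  wronskian : Tri → (P V : ℕ → Carrier) → ℕ → Carrier
  wronskian T P V m = sup T m * P m * V (suc m) - sub T (suc m) * P (suc m) * V m

  green : ∀ T {μ ν} P V m → Solves (transpose T) μ P m → Solves T ν V m →
          (ν - μ) * Σ< (suc m) (λ k → P k * V k) ≈ wronskian T P V m
  green T {μ} {ν} P V zero Pᵀ V↓ = begin
    (ν - μ) * (0# + P 0 * V 0)
      ≈⟨ solve 4 (λ ν μ P₀ V₀ → (ν :- μ) :* (con (+ 0) :+ P₀ :* V₀)
                              := P₀ :* (ν :* V₀) :- V₀ :* (μ :* P₀))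
           refl ν μ (P 0) (V 0) ⟩
    P 0 * (ν * V 0) - V 0 * (μ * P 0)
      ≈⟨ +-cong (*-congˡ (sym (V↓ 0 z≤n))) (-‿cong (*-congˡ (sym (Pᵀ 0 z≤n)))) ⟩
    P 0 * row T V 0 - V 0 * row (transpose T) P 0
      ≈⟨ solve 7 (λ P₀ V₀ α β γ V₁ P₁ → P₀ :* (α :* V₀ :+ β :* V₁) :- V₀ :* (α :* P₀ :+ γ :* P₁)
                                     := β :* P₀ :* V₁ :- γ :* P₁ :* V₀)
           refl (P 0) (V 0) (diag T 0) (sup T 0) (sub T 1) (V 1) (P 1) ⟩
    wronskian T P V 0 ∎
  green T {μ} {ν} P V (suc m) Pᵀ V↓ = begin
    (ν - μ) * (S + P′ * V′)
      ≈⟨ solve 5 (λ ν μ S P′ V′ → (ν :- μ) :* (S :+ P′ :* V′)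
                                := (ν :- μ) :* S :+ (P′ :* (ν :* V′) :- V′ :* (μ :* P′)))
           refl ν μ S P′ V′ ⟩
    (ν - μ) * S + (P′ * (ν * V′) - V′ * (μ * P′))
      ≈⟨ +-cong (green T P V m (λ k k≤m → Pᵀ k (ℕ.m≤n⇒m≤1+n k≤m))
                               (λ k k≤m → V↓ k (ℕ.m≤n⇒m≤1+n k≤m)))
                (+-cong (*-congˡ (sym (V↓ (suc m) ℕ.≤-refl)))
                        (-‿cong (*-congˡ (sym (Pᵀ (suc m) ℕ.≤-refl))))) ⟩
    wronskian T P V m + (P′ * row T V (suc m) - V′ * row (transpose T) P (suc m))
      ≈⟨ solve 11 (λ β P V′ γ P′ V α β′ V″ γ′ P″ →
                     (β :* P :* V′ :- γ :* P′ :* V)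
                       :+ (P′ :* (γ :* V :+ α :* V′ :+ β′ :* V″) :- V′ :* (β :* P :+ α :* P′ :+ γ′ :* P″))
                  := β′ :* P′ :* V″ :- γ′ :* P″ :* V′)
           refl (sup T m) (P m) V′ (sub T (suc m)) P′ (V m) (diag T (suc m)) (sup T (suc m))
                (V (suc (suc m))) (sub T (suc (suc m))) (P (suc (suc m))) ⟩
    wronskian T P V (suc m) ∎
    where
    S P′ V′ : Carrier
    S  = Σ< (suc m) (λ k → P k * V k)
    P′ = P (suc m)
    V′ = V (suc m)

  -- Green's identity through the last row d = e+1, when sup d = 0 and Tᵀ P = μ P is
  -- only known on the rows 0..e: what remains is the residual of row d of Tᵀ P = μ P
  -- (the entry below row d being dropped), times V d.
  green-top : ∀ T {μ ν} P V e → sup T (suc e) ≈ 0# →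
              Solves (transpose T) μ P e → Solves T ν V (suc e) →
              (ν - μ) * Σ< (suc (suc e)) (λ k → P k * V k)
                ≈ (sup T e * P e + diag T (suc e) * P (suc e) - μ * P (suc e)) * V (suc e)
  green-top T {μ} {ν} P V e sup≈0 Pᵀ V↓ = begin
    (ν - μ) * (S + P′ * V′)
      ≈⟨ solve 5 (λ ν μ S P′ V′ → (ν :- μ) :* (S :+ P′ :* V′)
                                := (ν :- μ) :* S :+ (P′ :* (ν :* V′) :- μ :* P′ :* V′))
           refl ν μ S P′ V′ ⟩
    (ν - μ) * S + (P′ * (ν * V′) - μ * P′ * V′)
      ≈⟨ +-cong (green T P V e Pᵀ (λ k k≤e → V↓ k (ℕ.m≤n⇒m≤1+n k≤e)))
                (+-congʳ (*-congˡ (sym (V↓ (suc e) ℕ.≤-refl)))) ⟩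
    wronskian T P V e + (P′ * row T V (suc e) - μ * P′ * V′)
      ≈⟨ solve 10 (λ β P V′ γ P′ V α β′ V″ μ →
                     (β :* P :* V′ :- γ :* P′ :* V)
                       :+ (P′ :* (γ :* V :+ α :* V′ :+ β′ :* V″) :- μ :* P′ :* V′)
                  := (β :* P :+ α :* P′ :- μ :* P′) :* V′ :+ β′ :* (P′ :* V″))
           refl (sup T e) (P e) V′ (sub T (suc e)) P′ (V e) (diag T (suc e)) (sup T (suc e))
                (V (suc (suc e))) μ ⟩
    residual * V′ + sup T (suc e) * (P′ * V (suc (suc e)))
      ≈⟨ +-congˡ (trans (*-congʳ sup≈0) (zeroˡ _)) ⟩
    residual * V′ + 0#
      ≈⟨ +-identityʳ _ ⟩
    residual * V′ ∎
    where
    S P′ V′ residual : Carrier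
    S  = Σ< (suc e) (λ k → P k * V k)
    P′ = P (suc e)
    V′ = V (suc e)
    residual = sup T e * P e + diag T (suc e) * P′ - μ * P′

  -- With a nonvanishing subdiagonal, a solution of T V = ν V on the rows 0..d is
  -- determined by its values at d and d+1: the rows can be solved downwards.
  vanishing : ∀ T {ν} V d → (∀ k → 1 ≤ k → k ≤ d → sub T k ≉ 0#) → Solves T ν V d →
              V d ≈ 0# → V (suc d) ≈ 0# → ∀ j → j ≤ d → V j ≈ 0#
  vanishing T {ν} V d sub≉0 V↓ Vd≈0 Vd+1≈0 j j≤d =
    proj₁ (downward (d ∸ j) j (ℕ.m+[n∸m]≡n j≤d))
    where
    downward : ∀ t j → j ℕ.+ t ≡ d → V j ≈ 0# × V (suc j) ≈ 0#
    downward zero j j+0≡d rewrite ℕ.+-identityʳ j | j+0≡d = Vd≈0 , Vd+1≈0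
    downward (suc t) j j+t+1≡d = cancel (sub≉0 (suc j) (s≤s z≤n) sj≤d) γVj≈0 , V′≈0
      where
      sj+t≡d : suc j ℕ.+ t ≡ d
      sj+t≡d = ≡.trans (≡.sym (ℕ.+-suc j t)) j+t+1≡d
      sj≤d : suc j ≤ d
      sj≤d = ≡.subst (suc j ≤_) sj+t≡d (ℕ.m≤m+n (suc j) t)
      V′≈0 : V (suc j) ≈ 0#
      V′≈0 = proj₁ (downward t (suc j) sj+t≡d)
      V″≈0 : V (suc (suc j)) ≈ 0#
      V″≈0 = proj₂ (downward t (suc j) sj+t≡d)
      γ α β : Carrier
      γ = sub T (suc j); α = diag T (suc j); β = sup T (suc j)
      γVj≈0 : γ * V j ≈ 0#
      γVj≈0 = begin
        γ * V j
          ≈⟨ solve 6 (λ γ V α V′ β V″ → γ :* V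
                                       := (γ :* V :+ α :* V′ :+ β :* V″) :- α :* V′ :- β :* V″)
               refl γ (V j) α (V (suc j)) β (V (suc (suc j))) ⟩
        row T V (suc j) - α * V (suc j) - β * V (suc (suc j))
          ≈⟨ +-cong (+-cong (trans (V↓ (suc j) sj≤d) (*-congˡ V′≈0)) (-‿cong (*-congˡ V′≈0)))
                    (-‿cong (*-congˡ V″≈0)) ⟩
        ν * 0# - α * 0# - β * 0#
          ≈⟨ solve 3 (λ ν α β → ν :* con (+ 0) :- α :* con (+ 0) :- β :* con (+ 0) := con (+ 0))
               refl ν α β ⟩
        0# ∎

module IntersectionMatrix {o ℓ : Level} (F : CharZeroField o ℓ) (κ : ℕ) (b c : ℕ → ℕ) (e : ℕ)
  (b₀≡κ : b 0 ≡ κ) (c₀≡0 : c 0 ≡ 0) (c₁≡1 : c 1 ≡ 1) (b-top≡0 : b (suc e) ≡ 0)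
  (c-positive : ∀ k → 1 ≤ k → k ≤ suc e → 1 ≤ c k) where
  open CharZeroField F hiding (zero)
  open FieldDefs F
  open FieldLemmas F
  open Tridiagonal F
  open Intersection κ b c
  open IntegerCoefficientSolver commRing
  open import Algebra.Properties.Ring (CommutativeRing.ring commRing) using (x∙y⁻¹≈ε⇒x≈y)
  open import Relation.Binary.Reasoning.Setoid setoid

  d : ℕ
  d = suc e

  Q-tri : Tri
  Q-tri = record { sup = λ k → ιF (b k) ; sub = λ k → ιF (c k) ; diag = a }

  ones-solve : Solves Q-tri (ιF κ) (λ _ → 1#) d
  ones-solve zero _ = begin
    (κ′ - β - γ) * 1# + β * 1#   ≈⟨ solve 3 (λ κ β γ → (κ :- β :- γ) :* con (+ 1) :+ β :* con (+ 1)
                                                        := κ :* con (+ 1) :- γ)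
                                           refl κ′ β γ ⟩
    κ′ * 1# - γ                  ≈⟨ +-congˡ (-‿cong (reflexive (≡.cong ιF c₀≡0))) ⟩
    κ′ * 1# - 0#                 ≈⟨ solve 1 (λ x → x :- con (+ 0) := x) refl (κ′ * 1#) ⟩
    κ′ * 1#                      ∎
    where
    κ′ β γ : Carrier
    κ′ = ιF κ; β = ιF (b 0); γ = ιF (c 0)
  ones-solve (suc k) _ =
    solve 3 (λ γ κ β → γ :* con (+ 1) :+ (κ :- β :- γ) :* con (+ 1) :+ β :* con (+ 1)
                       := κ :* con (+ 1))
      refl (ιF (c (suc k))) (ιF κ) (ιF (b (suc k)))

  -- The recurrence defining pₖ says exactly that (p₀(μ), p₁(μ), …) solves the rows
  -- 0..d-1 of Qᵀ P = μ P; row 0 holds because a₀ = 0 and c₁ = 1, and row k+1 because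
  -- c_{k+2} ≠ 0 can be divided out.
  p-solves : ∀ μ → Solves (transpose Q-tri) μ (λ k → p k μ) e
  p-solves μ zero _ = begin
    a 0 * 1# + ιF (c 1) * μ   ≈⟨ +-cong (*-congʳ a₀≈0) (*-congʳ (reflexive (≡.cong ιF c₁≡1))) ⟩
    0# * 1# + (1# + 0#) * μ   ≈⟨ solve 1 (λ μ → con (+ 0) :* con (+ 1) :+ (con (+ 1) :+ con (+ 0)) :* μ
                                                 := μ :* con (+ 1)) refl μ ⟩
    μ * 1#                    ∎
    where
    a₀≈0 : a 0 ≈ 0#
    a₀≈0 = begin
      ιF κ - ιF (b 0) - ιF (c 0)  ≡⟨ ≡.cong₂ (λ β γ → ιF κ - ιF β - ιF γ) b₀≡κ c₀≡0 ⟩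
      ιF κ - ιF κ - 0#            ≈⟨ solve 1 (λ κ → κ :- κ :- con (+ 0) := con (+ 0)) refl (ιF κ) ⟩
      0#                          ∎
  p-solves μ (suc k) (s≤s k<e) = begin
    β * P + α * P′ + γ * (E * γ ⁻¹)
      ≈⟨ +-congˡ (*-cancel-⁻¹ E (ιF-nonzero (c-positive (suc (suc k)) (s≤s z≤n) (s≤s (s≤s k<e))))) ⟩
    β * P + α * P′ + E
      ≈⟨ solve 5 (λ β P α P′ μ → β :* P :+ α :* P′ :+ (μ :* P′ :- α :* P′ :- β :* P) := μ :* P′)
           refl β P α P′ μ ⟩
    μ * P′ ∎
    where
    β γ α P P′ E : Carrier
    β = ιF (b k); γ = ιF (c (suc (suc k))); α = a (suc k)
    P = p k μ; P′ = p (suc k) μ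
    -- c_{k+2} p_{k+2}(μ) = E by the recurrence
    E = μ * P′ - α * P′ - β * P

  eigenvector-solves : ∀ {μ} (v : Fin (suc d) → Carrier) →
    (∀ k → ΣFin (λ l → Q d k l * v l) ≈ μ * v k) → Solves Q-tri μ (pad v) d
  eigenvector-solves {μ} v Qv≈μv k k≤d =
    ≡.subst (λ j → row Q-tri (pad v) j ≈ μ * pad v j) (Fin.toℕ-fromℕ< (s≤s k≤d))
      (row-at (Fin.fromℕ< (s≤s k≤d)))
    where
    row-at : ∀ (k : Fin (suc d)) → row Q-tri (pad v) (toℕ k) ≈ μ * pad v (toℕ k)
    row-at k = begin
      row Q-tri (pad v) (toℕ k)
        ≈⟨ rowSum Q-tri (pad v) d (toℕ k) (Fin.toℕ≤pred[n] k) (reflexive (≡.cong ιF b-top≡0)) ⟨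
      ΣFin (λ l → Q d k l * pad v (toℕ l))
        ≈⟨ ΣFin-cong {g = λ l → Q d k l * v l} (λ l → *-congˡ (reflexive (pad-toℕ v l))) ⟩
      ΣFin (λ l → Q d k l * v l)
        ≈⟨ Qv≈μv k ⟩
      μ * v k
        ≡⟨ ≡.cong (μ *_) (pad-toℕ v k) ⟨
      μ * pad v (toℕ k) ∎

  -- The heart of the theorem: for an eigenvalue μ ≠ κ of Q, q_d(μ) = 0.
  -- Green's identity for P = (pₖ(μ)) against an eigenvector V for μ shows that the
  -- residual of the last row of Qᵀ P = μ P vanishes (V_d ≠ 0 as V is nonzero);
  -- against the all-ones vector it then gives (κ - μ) q_d(μ) = 0.
  q-vanishes : ∀ μ → IsEigenvalueQ d μ → ιF κ ≉ μ → q d μ ≈ 0#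
  q-vanishes μ (v , (k , vₖ≉0) , Qv≈μv) κ≉μ = cancel κ-μ≉0 (begin
    (ιF κ - μ) * q d μ
      ≈⟨ *-congˡ (Σ<-cong (suc d) (λ j → sym (*-identityʳ (P j)))) ⟩
    (ιF κ - μ) * Σ< (suc d) (λ j → P j * 1#)
      ≈⟨ green-top Q-tri P (λ _ → 1#) e sup≈0 (p-solves μ) ones-solve ⟩
    residual * 1#
      ≈⟨ *-congʳ residual≈0 ⟩
    0# * 1#
      ≈⟨ zeroˡ 1# ⟩
    0# ∎)
    where
    P : ℕ → Carrier
    P j = p j μ
    V : ℕ → Carrier
    V = pad v
    sup≈0 : ιF (b d) ≈ 0#
    sup≈0 = reflexive (≡.cong ιF b-top≡0)
    residual : Carrier
    residual = ιF (b e) * P e + a d * P d - μ * P d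

    Vd≉0 : V d ≉ 0#
    Vd≉0 Vd≈0 = vₖ≉0 (begin
      v k          ≡⟨ pad-toℕ v k ⟨
      V (toℕ k)    ≈⟨ vanishing Q-tri V d (λ j 1≤j j≤d → ιF-nonzero (c-positive j 1≤j j≤d))
                       (eigenvector-solves v Qv≈μv) Vd≈0 (reflexive (pad-end (suc d) v))
                       (toℕ k) (Fin.toℕ≤pred[n] k) ⟩
      0#           ∎)

    residual≈0 : residual ≈ 0#
    residual≈0 = cancel Vd≉0 (begin
      V d * residual                          ≈⟨ *-comm _ _ ⟩
      residual * V d                          ≈⟨ green-top Q-tri P V e sup≈0 (p-solves μ)
                                                   (eigenvector-solves v Qv≈μv) ⟨
      (μ - μ) * Σ< (suc d) (λ j → P j * V j)  ≈⟨ *-congʳ (-‿inverseʳ μ) ⟩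
      0# * Σ< (suc d) (λ j → P j * V j)       ≈⟨ zeroˡ _ ⟩
      0#                                      ∎)

    κ-μ≉0 : ιF κ - μ ≉ 0#
    κ-μ≉0 κ-μ≈0 = κ≉μ (x∙y⁻¹≈ε⇒x≈y (ιF κ) μ κ-μ≈0)

mainTheorem2 :
  ∀ {o ℓ : Level} (F : CharZeroField o ℓ) →
  let open CharZeroField F
      open FieldDefs F
  in
  (n : ℕ) (G : Graph n) (δ : Fin n → Fin n → ℕ) (d κ : ℕ) (b c : ℕ → ℕ) →
  Connected G →
  IsDistance G δ →
  IsDiameter G δ d →
  IsDistanceRegular δ →
  IsValency δ κ →
  IsBNumbers δ d b →
  IsCNumbers δ d c →
  let open Intersection κ b c in
  (λs : Fin (suc d) → Carrier) →
  λs Fin.zero ≈ ιF κ →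
  (∀ i j → λs i ≈ λs j → i ≡ j) →
  (∀ i → IsEigenvalueQ d (λs i)) →
  ∀ i → i ≢ Fin.zero →
    (∀ z → φ d (λs i) z ≈ (1# - z) * Σ< d (λ m → q m (λs i) * pow z m))
    × p d (λs i) ≈ - q (d ∸ 1) (λs i)
    × q d (λs i) ≈ 0#
-- For d = 0 there is no eigenvalue index i ≠ 0; otherwise d = e + 1, and everything
-- follows from q-vanishes, using the graph-theoretic facts on b and c.
mainTheorem2 F n G δ zero κ b c _ _ _ _ _ _ _ λs _ _ _ Fin.zero i≢0 = ⊥-elim (i≢0 ≡.refl)
mainTheorem2 F n G δ (suc e) κ b c _ isDist isDiam _ valency bNum cNum λs λ₀≈κ λs-injective eigen i i≢0 =
  φ-factorises , p-top , q-top≈0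
  where
  open CharZeroField F
  open FieldDefs F
  open FieldLemmas F
  open Intersection κ b c
  open IntersectionNumbers G δ (suc e) isDist isDiam
  open IntersectionMatrix F κ b c e (b₀≡κ valency bNum (s≤s z≤n)) (proj₂ cNum) (c₁≡1 cNum (s≤s z≤n))
                          (proj₂ bNum) (c-positive cNum)
  open import Algebra.Properties.Ring (CommutativeRing.ring commRing) using (+-inverseʳ-unique)

  μ : Carrier
  μ = λs i

  κ≉μ : ιF κ ≉ μ
  κ≉μ κ≈μ = i≢0 (≡.sym (λs-injective Fin.zero i (trans λ₀≈κ κ≈μ)))

  q-top≈0 : q (suc e) μ ≈ 0#
  q-top≈0 = q-vanishes μ (eigen i) κ≉μ

  -- q_d = q_{d-1} + p_d
  p-top : p (suc e) μ ≈ - q e μ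
  p-top = +-inverseʳ-unique (q e μ) (p (suc e) μ) q-top≈0

  -- Abel summation, where the last term q_d(μ) zᵈ vanishes
  φ-factorises : ∀ z → φ (suc e) μ z ≈ (1# - z) * Σ< (suc e) (λ m → q m μ * pow z m)
  φ-factorises z = trans (abel-summation (λ l → p l μ) (suc e) z)
    (trans (+-congˡ (trans (*-congʳ q-top≈0) (zeroˡ _))) (+-identityʳ _))
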